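{- Let $k\ge3$ be odd, let $d$ be an integer with $1\le d\le k-1$ and $\gcd(d,k)=1$, and let $G$ be a graph. Let $G(d,k)$ be the graph obtained from $G$ by applying the $d$-$C_k$-replacement operation to every edge of $G$ (using a new $k$-cycle for each edge). Then $G$ admits a $C_k$-coloring if and only if $G(d,k)$ admits a $C_k$-coloring.
   Context: A $d$-$C_k$-replacement on an edge $xy$ of a graph replaces the edge $xy$ by a $k$-cycle $v_0v_1\cdots v_{k-1}v_0$ whose vertices other than $v_0,v_d$ are new, identifying $x$ with $v_0$ and $y$ with $v_d$. For odd $k\ge3$, a $C_k$-coloring of a graph $H$ is a map $\varphi:V(H)\to\{0,\dots,k-1\}$ with $\frac{k-1}{2}\le|\varphi(u)-\varphi(v)|\le\frac{k+1}{2}$ for every edge $uv$. -}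

module Defs where

open import Data.Nat using (ℕ; zero; suc; _+_; _∸_; _≤_; _≟_; ⌊_/2⌋; ∣_-_∣)
open import Data.Fin using (Fin; toℕ)
open import Data.Product using (Σ; _×_; _,_; proj₁; proj₂; swap)
open import Data.Sum using (_⊎_; inj₁; inj₂)
open import Relation.Binary.PropositionalEquality using (_≡_; _≢_)
open import Relation.Nullary using (yes; no)
open import Relation.Nullary.Decidable using (False; fromWitnessFalse)

-- A finite simple graph on vertex set Fin n with m edges; each edge e is
-- listed exactly once, with an (arbitrary) orientation ends e = (x , y).
record SimpleGraph : Set where
  field
    n m      : ℕ
    ends     : Fin m → Fin n × Fin n
    loopless : ∀ e → proj₁ (ends e) ≢ proj₂ (ends e)
    noMulti  : ∀ e e' → (ends e ≡ ends e' ⊎ ends e ≡ swap (ends e')) → e ≡ e'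

Adj : (G : SimpleGraph) → Fin (SimpleGraph.n G) → Fin (SimpleGraph.n G) → Set
Adj G u v = Σ (Fin m) λ e → ends e ≡ (u , v) ⊎ ends e ≡ (v , u)
  where open SimpleGraph G

IsCkColoring : (k : ℕ) {V : Set} (A : V → V → Set) → (V → Fin k) → Set
IsCkColoring k {V} A φ = ∀ u v → A u v →
  (⌊ k ∸ 1 /2⌋ ≤ ∣ toℕ (φ u) - toℕ (φ v) ∣) × (∣ toℕ (φ u) - toℕ (φ v) ∣ ≤ ⌊ k + 1 /2⌋)

CkColorable : (k : ℕ) {V : Set} (A : V → V → Set) → Set
CkColorable k {V} A = Σ (V → Fin k) λ φ → IsCkColoring k A φ

CycAdj : (k : ℕ) → Fin k → Fin k → Set
CycAdj k i j = (suc (toℕ i) ≡ toℕ j) ⊎ ((suc (toℕ i) ≡ k) × (toℕ j ≡ 0))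

-- Positions of the cycle other than 0 and d (these are the new vertices).
Inner : (k d : ℕ) → Set
Inner k d = Σ (Fin k) λ i → False (toℕ i ≟ 0) × False (toℕ i ≟ d)

module _ (G : SimpleGraph) (d k : ℕ) where
  open SimpleGraph G

  RVertex : Set
  RVertex = Fin n ⊎ (Fin m × Inner k d)

  -- The vertex of G(d,k) at position i of the cycle replacing edge e = xy
  -- (v_0 = x, v_d = y).
  pos : Fin m → Fin k → RVertex
  pos e i with toℕ i ≟ 0
  ... | yes _ = inj₁ (proj₁ (ends e))
  ... | no i≢0 with toℕ i ≟ d
  ...   | yes _ = inj₁ (proj₂ (ends e))
  ...   | no i≢d = inj₂ (e , i , fromWitnessFalse i≢0 , fromWitnessFalse i≢d)

  RAdj : RVertex → RVertex → Set
  RAdj u w = Σ (Fin m) λ e → Σ (Fin k) λ i → Σ (Fin k) λ j → CycAdj k i j ×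
    ((pos e i ≡ u × pos e j ≡ w) ⊎ (pos e i ≡ w × pos e j ≡ u))

-- Write k = 2s + 1. For colours a, b < k the C_k condition s ≤ |a − b| ≤ s + 1 says exactly that
-- b ≡ a + t (mod k) for some t ∈ {s, s + 1}. Given a colouring φ of G and an edge xy with
-- φ(y) ≡ φ(x) + t, colour each old vertex v by d·φ(v) and position i of the cycle replacing xy by
-- d·φ(x) + i·t: consecutive positions differ by t, the cycle closes because k·t ≡ 0, and position d
-- receives d·φ(y). Conversely, a colouring Φ of G(d,k) goes around each replacing cycle in k steps
-- from {s, s + 1} summing to 0 mod k; since k·s ≡ 0 the number of (s + 1)-steps is 0 or k, so all
-- steps equal a single t. Hence Φ(y) ≡ Φ(x) + d·t, and multiplying by an inverse of d mod k gives a
-- colouring of G.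
module Submission where

open import Defs
open import Data.Bool using (Bool; true; false; not; if_then_else_)
open import Data.Fin using (Fin; toℕ)
open import Data.Fin.Properties using (toℕ<n; toℕ-fromℕ<; toℕ-injective)
open import Data.Nat
open import Data.Nat.DivMod
open import Data.Nat.GCD using (gcd; GCD; gcd-GCD; module Bézout)
open import Data.Nat.Properties
open import Data.Nat.Tactic.RingSolver using (solve-∀)
open import Data.Product using (Σ; _×_; _,_; proj₁; proj₂; map₂)
open import Data.Sum using (_⊎_; inj₁; inj₂)
open import Function using (_∘_)
open import Function.Bundles using (_⇔_; mk⇔)
open import Relation.Binary.PropositionalEquality
open import Relation.Nullary using (yes; no; contradiction)

module Modular (k : ℕ) .{{_ : NonZero k}} where

  infix 4 _≈_
  _≈_ : ℕ → ℕ → Set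
  a ≈ b = a % k ≡ b % k

  toℕ-mod-≈ : ∀ a → toℕ (a mod k) ≈ a
  toℕ-mod-≈ a = trans (cong (_% k) (toℕ-fromℕ< (m%n<n a k))) (m%n%n≡m%n a k)

  +-congʳ-≈ : ∀ {a b} c → a ≈ b → a + c ≈ b + c
  +-congʳ-≈ {a} {b} c a≈b = begin
    (a + c) % k               ≡⟨ %-distribˡ-+ a c k ⟩
    (a % k + c % k) % k       ≡⟨ cong (λ z → (z + c % k) % k) a≈b ⟩
    (b % k + c % k) % k       ≡⟨ %-distribˡ-+ b c k ⟨
    (b + c) % k               ∎
    where open ≡-Reasoning

  +-congˡ-≈ : ∀ c {a b} → a ≈ b → c + a ≈ c + b
  +-congˡ-≈ c {a} {b} a≈b = subst₂ _≈_ (+-comm a c) (+-comm b c) (+-congʳ-≈ c a≈b)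

  *-congˡ-≈ : ∀ c {a b} → a ≈ b → c * a ≈ c * b
  *-congˡ-≈ c {a} {b} a≈b = begin
    (c * a) % k               ≡⟨ %-distribˡ-* c a k ⟩
    (c % k * (a % k)) % k     ≡⟨ cong (λ z → (c % k * z) % k) a≈b ⟩
    (c % k * (b % k)) % k     ≡⟨ %-distribˡ-* c b k ⟨
    (c * b) % k               ∎
    where open ≡-Reasoning

  *-congʳ-≈ : ∀ {a b} c → a ≈ b → a * c ≈ b * c
  *-congʳ-≈ {a} {b} c a≈b = subst₂ _≈_ (*-comm c a) (*-comm c b) (*-congˡ-≈ c a≈b)

  -- Adding k ∸ a % k to a + b leaves b plus a multiple of k.
  +-cancelˡ-≈ : ∀ a {b c} → a + b ≈ a + c → b ≈ c
  +-cancelˡ-≈ a {b} {c} ab≈ac = trans (translate b) (trans shifted (sym (translate c)))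
    where
      r : ℕ
      r = a % k
      r+[k∸r]≡k : r + (k ∸ r) ≡ k
      r+[k∸r]≡k = m+[n∸m]≡n (m%n≤n a k)
      translate : ∀ x → x % k ≡ ((r + x) % k + (k ∸ r)) % k
      translate x = begin
        x % k                       ≡⟨ [m+n]%n≡m%n x k ⟨
        (x + k) % k                 ≡⟨ cong (λ z → (x + z) % k) r+[k∸r]≡k ⟨
        (x + (r + (k ∸ r))) % k     ≡⟨ cong (_% k) (trans (sym (+-assoc x r (k ∸ r))) (cong (_+ (k ∸ r)) (+-comm x r))) ⟩
        (r + x + (k ∸ r)) % k       ≡⟨ +-congʳ-≈ (k ∸ r) (m%n%n≡m%n (r + x) k) ⟨
        ((r + x) % k + (k ∸ r)) % k ∎
        where open ≡-Reasoning
      r+b≈r+c : (r + b) % k ≡ (r + c) % k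
      r+b≈r+c = trans (+-congʳ-≈ b (m%n%n≡m%n a k)) (trans ab≈ac (sym (+-congʳ-≈ c (m%n%n≡m%n a k))))
      shifted : ((r + b) % k + (k ∸ r)) % k ≡ ((r + c) % k + (k ∸ r)) % k
      shifted = cong (λ z → (z + (k ∸ r)) % k) r+b≈r+c

  ≤∧≈0⇒≡0⊎≡ : ∀ {a} → a ≤ k → a ≈ 0 → a ≡ 0 ⊎ a ≡ k
  ≤∧≈0⇒≡0⊎≡ a≤k a≈0 with m≤n⇒m<n∨m≡n a≤k
  ... | inj₁ a<k = inj₁ (trans (sym (m<n⇒m%n≡m a<k)) (trans a≈0 (m*n%n≡0 0 k)))
  ... | inj₂ a≡k = inj₂ a≡k

  ≈-wraps-once : ∀ {a b t} → b < k → a + t < k + k → b ≈ a + t → a + t ≡ b ⊎ a + t ≡ b + k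
  ≈-wraps-once {a} {b} {t} b<k a+t<k+k b≈a+t = wrap ((a + t) / k) quotient<2
    (trans (m≡m%n+[m/n]*n (a + t) k) (cong (_+ (a + t) / k * k) residue≡b))
    where
      quotient<2 : (a + t) / k < 2
      quotient<2 = m<n*o⇒m/o<n (subst (a + t <_) (cong (k +_) (sym (+-identityʳ k))) a+t<k+k)
      residue≡b : (a + t) % k ≡ b
      residue≡b = trans (sym b≈a+t) (m<n⇒m%n≡m b<k)
      wrap : ∀ q → q < 2 → a + t ≡ b + q * k → a + t ≡ b ⊎ a + t ≡ b + k
      wrap 0 _ eq = inj₁ (trans eq (+-identityʳ b))
      wrap 1 _ eq = inj₂ (trans eq (cong (b +_) (+-identityʳ k)))
      wrap (2+ _) (s≤s (s≤s ())) _

  cycAdj⇒≈suc : ∀ {i j} → CycAdj k i j → toℕ j ≈ suc (toℕ i)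
  cycAdj⇒≈suc (inj₁ 1+i≡j)        = cong (_% k) (sym 1+i≡j)
  cycAdj⇒≈suc (inj₂ (1+i≡k , j≡0)) =
    trans (cong (_% k) j≡0) (trans (m*n%n≡0 0 k) (sym (trans (cong (_% k) 1+i≡k) (n%n≡0 k))))

  cycAdj-mod : ∀ n → CycAdj k (n mod k) (suc n mod k)
  cycAdj-mod n = adjacent (m≤n⇒m<n∨m≡n (m%n<n n k))
    where
      toℕ-suc-mod : toℕ (suc n mod k) ≡ suc (n % k) % k
      toℕ-suc-mod = trans (toℕ-fromℕ< _) (+-congˡ-≈ 1 (sym (m%n%n≡m%n n k)))
      adjacent : suc (n % k) < k ⊎ suc (n % k) ≡ k → CycAdj k (n mod k) (suc n mod k)
      adjacent (inj₁ 1+r<k) =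
        inj₁ (trans (cong suc (toℕ-fromℕ< _)) (sym (trans toℕ-suc-mod (m<n⇒m%n≡m 1+r<k))))
      adjacent (inj₂ 1+r≡k) =
        inj₂ (trans (cong suc (toℕ-fromℕ< _)) 1+r≡k , trans toℕ-suc-mod (trans (cong (_% k) 1+r≡k) (n%n≡0 k)))

  y≈x+dt⇒d⁻¹y≈d⁻¹x+t : ∀ {x y t} d d⁻¹ → d⁻¹ * d ≈ 1 → y ≈ x + d * t → d⁻¹ * y ≈ d⁻¹ * x + t
  y≈x+dt⇒d⁻¹y≈d⁻¹x+t {x} {y} {t} d d⁻¹ d⁻¹*d≈1 y≈x+dt = begin
    d⁻¹ * y % k                    ≡⟨ *-congˡ-≈ d⁻¹ y≈x+dt ⟩
    d⁻¹ * (x + d * t) % k          ≡⟨ cong (_% k) (*-distribˡ-+ d⁻¹ x (d * t)) ⟩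
    (d⁻¹ * x + d⁻¹ * (d * t)) % k  ≡⟨ cong (λ z → (d⁻¹ * x + z) % k) (*-assoc d⁻¹ d t) ⟨
    (d⁻¹ * x + d⁻¹ * d * t) % k    ≡⟨ +-congˡ-≈ (d⁻¹ * x) (*-congʳ-≈ t d⁻¹*d≈1) ⟩
    (d⁻¹ * x + 1 * t) % k          ≡⟨ cong (λ z → (d⁻¹ * x + z) % k) (*-identityˡ t) ⟩
    (d⁻¹ * x + t) % k              ∎
    where open ≡-Reasoning

  gcd≡1⇒invertible : ∀ {d} → gcd d k ≡ 1 → Σ ℕ λ d⁻¹ → d⁻¹ * d ≈ 1
  gcd≡1⇒invertible {d} gcd≡1 with Bézout.identity (subst (GCD d k) gcd≡1 (gcd-GCD d k))
  ... | Bézout.+- x y eq = x , (begin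
    x * d % k               ≡⟨ cong (_% k) eq ⟨
    (1 + y * k) % k         ≡⟨ [m+kn]%n≡m%n 1 y k ⟩
    1 % k                   ∎)
    where open ≡-Reasoning
  ... | Bézout.-+ x y eq = p * x , (begin
    p * x * d % k           ≡⟨ [m+n]%n≡m%n (p * x * d) k ⟨
    (p * x * d + k) % k     ≡⟨ cong (λ z → (p * x * d + z) % k) (suc-pred k) ⟨
    (p * x * d + suc p) % k ≡⟨ cong (_% k) (distribute p x d) ⟩
    (1 + p * (1 + x * d)) % k ≡⟨ cong (λ z → (1 + p * z) % k) eq ⟩
    (1 + p * (y * k)) % k   ≡⟨ cong (λ z → (1 + z) % k) (*-assoc p y k) ⟨
    (1 + p * y * k) % k     ≡⟨ [m+kn]%n≡m%n 1 (p * y) k ⟩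
    1 % k                   ∎)
    where
      open ≡-Reasoning
      p : ℕ
      p = pred k
      distribute : ∀ p x d → p * x * d + suc p ≡ 1 + p * (1 + x * d)
      distribute = solve-∀

trues : (ℕ → Bool) → ℕ → ℕ
trues β zero    = 0
trues β (suc n) = if β n then suc (trues β n) else trues β n

trues≤ : ∀ β n → trues β n ≤ n
trues≤ β zero = z≤n
trues≤ β (suc n) with β n
... | false = m≤n⇒m≤1+n (trues≤ β n)
... | true  = s≤s (trues≤ β n)

trues-mono : ∀ β {m n} → m ≤ n → trues β m ≤ trues β n
trues-mono β {n = zero} z≤n = z≤n
trues-mono β {m} {suc n} m≤1+n with m≤n⇒m<n∨m≡n m≤1+n
... | inj₂ refl = ≤-refl
... | inj₁ (s≤s m≤n) with β n
...   | false = trues-mono β m≤n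
...   | true  = m≤n⇒m≤1+n (trues-mono β m≤n)

trues+trues∘not : ∀ β n → trues β n + trues (not ∘ β) n ≡ n
trues+trues∘not β zero = refl
trues+trues∘not β (suc n) with β n
... | false = trans (+-suc (trues β n) _) (cong suc (trues+trues∘not β n))
... | true  = cong suc (trues+trues∘not β n)

trues≡0-downward : ∀ β {m n} → trues β n ≡ 0 → m ≤ n → trues β m ≡ 0
trues≡0-downward β trues≡0 m≤n = n≤0⇒n≡0 (subst (_ ≤_) trues≡0 (trues-mono β m≤n))

trues≡n-downward : ∀ β {m n} → trues β n ≡ n → m ≤ n → trues β m ≡ m
trues≡n-downward β {m} {n} trues≡n m≤n = begin
  trues β m                              ≡⟨ +-identityʳ _ ⟨
  trues β m + 0                          ≡⟨ cong (trues β m +_) (trues≡0-downward (not ∘ β) no-falses m≤n) ⟨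
  trues β m + trues (not ∘ β) m          ≡⟨ trues+trues∘not β m ⟩
  m                                      ∎
  where
    open ≡-Reasoning
    no-falses : trues (not ∘ β) n ≡ 0
    no-falses = +-cancelˡ-≡ n _ 0
      (trans (cong (_+ trues (not ∘ β) n) (sym trues≡n)) (trans (trues+trues∘not β n) (sym (+-identityʳ n))))

m+∣m-n∣≡n⊎n+∣m-n∣≡m : ∀ m n → m + ∣ m - n ∣ ≡ n ⊎ n + ∣ m - n ∣ ≡ m
m+∣m-n∣≡n⊎n+∣m-n∣≡m m n with ≤-total m n
... | inj₁ m≤n = inj₁ (trans (cong (m +_) (m≤n⇒∣m-n∣≡n∸m m≤n)) (m+[n∸m]≡n m≤n))
... | inj₂ n≤m = inj₂ (trans (cong (n +_) (trans (∣-∣-comm m n) (m≤n⇒∣m-n∣≡n∸m n≤m))) (m+[n∸m]≡n n≤m))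

module _ (G : SimpleGraph) (d k : ℕ) where
  open SimpleGraph G

  pos-head : ∀ e i → toℕ i ≡ 0 → pos G d k e i ≡ inj₁ (proj₁ (ends e))
  pos-head e i i≡0 with toℕ i ≟ 0
  ... | yes _   = refl
  ... | no  i≢0 = contradiction i≡0 i≢0

  pos-tail : d ≢ 0 → ∀ e i → toℕ i ≡ d → pos G d k e i ≡ inj₁ (proj₂ (ends e))
  pos-tail d≢0 e i i≡d with toℕ i ≟ 0
  ... | yes i≡0 = contradiction (trans (sym i≡d) i≡0) d≢0
  ... | no  _ with toℕ i ≟ d
  ...   | yes _   = refl
  ...   | no  i≢d = contradiction i≡d i≢d

module OddCycle {k s : ℕ} (k≡1+2s : k ≡ suc (s + s)) where

  instance
    k-nonZero : NonZero k
    k-nonZero = >-nonZero (subst (0 <_) (sym k≡1+2s) z<s)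

  open Modular k

  InBand : ℕ → Set
  InBand δ = (⌊ k ∸ 1 /2⌋ ≤ δ) × (δ ≤ ⌊ k + 1 /2⌋)

  CkClose : ℕ → ℕ → Set
  CkClose a b = InBand ∣ a - b ∣

  CkClose-sym : ∀ a b → CkClose a b → CkClose b a
  CkClose-sym a b = subst InBand (∣-∣-comm a b)

  ⌊k∸1/2⌋≡s : ⌊ k ∸ 1 /2⌋ ≡ s
  ⌊k∸1/2⌋≡s = trans (cong (λ k → ⌊ k ∸ 1 /2⌋) k≡1+2s) (sym (n≡⌊n+n/2⌋ s))

  ⌊k+1/2⌋≡1+s : ⌊ k + 1 /2⌋ ≡ suc s
  ⌊k+1/2⌋≡1+s = trans (cong ⌊_/2⌋ (trans (+-comm k 1) (cong suc k≡1+2s))) (cong suc (sym (n≡⌊n+n/2⌋ s)))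

  offset : Bool → ℕ
  offset false = s
  offset true  = suc s

  offset+offset∘not : ∀ β → offset β + offset (not β) ≡ k
  offset+offset∘not false = trans (+-suc s s) (sym k≡1+2s)
  offset+offset∘not true  = sym k≡1+2s

  offset-inBand : ∀ β → InBand (offset β)
  offset-inBand false = ≤-reflexive ⌊k∸1/2⌋≡s , ≤-trans (n≤1+n s) (≤-reflexive (sym ⌊k+1/2⌋≡1+s))
  offset-inBand true  = ≤-trans (≤-reflexive ⌊k∸1/2⌋≡s) (n≤1+n s) , ≤-reflexive (sym ⌊k+1/2⌋≡1+s)

  offset≤k : ∀ β → offset β ≤ k
  offset≤k β = subst (offset β ≤_) (offset+offset∘not β) (m≤m+n (offset β) _)

  inBand⇒offset : ∀ {δ} → InBand δ → Σ Bool λ β → offset β ≡ δ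
  inBand⇒offset {δ} (lo , hi) with s ≟ δ
  ... | yes s≡δ = false , s≡δ
  ... | no  s≢δ = true , ≤-antisym (≤∧≢⇒< (subst (_≤ δ) ⌊k∸1/2⌋≡s lo) s≢δ) (subst (δ ≤_) ⌊k+1/2⌋≡1+s hi)

  close⇒step : ∀ {a b} → CkClose a b → Σ Bool λ β → b ≈ a + offset β
  close⇒step {a} {b} band with inBand⇒offset band | m+∣m-n∣≡n⊎n+∣m-n∣≡m a b
  ... | β , t≡∣a-b∣ | inj₁ a+∣a-b∣≡b = β , cong (_% k) (sym (trans (cong (a +_) t≡∣a-b∣) a+∣a-b∣≡b))
  ... | β , t≡∣a-b∣ | inj₂ b+∣a-b∣≡a = not β , (begin
    b % k                                ≡⟨ [m+n]%n≡m%n b k ⟨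
    (b + k) % k                          ≡⟨ cong (λ z → (b + z) % k) (offset+offset∘not β) ⟨
    (b + (offset β + offset (not β))) % k ≡⟨ cong (_% k) (+-assoc b _ _) ⟨
    (b + offset β + offset (not β)) % k   ≡⟨ cong (λ z → (z + offset (not β)) % k) (trans (cong (b +_) t≡∣a-b∣) b+∣a-b∣≡a) ⟩
    (a + offset (not β)) % k             ∎)
    where open ≡-Reasoning

  step⇒close : ∀ {a b} β → a < k → b < k → b ≈ a + offset β → CkClose a b
  step⇒close {a} {b} β a<k b<k b≈a+t
    with ≈-wraps-once {a} {b} {offset β} b<k (+-mono-<-≤ a<k (offset≤k β)) b≈a+t
  ... | inj₁ a+t≡b = subst InBand (sym (trans (cong (∣ a -_∣) (sym a+t≡b)) (∣m-m+n∣≡n a _))) (offset-inBand β)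
  ... | inj₂ a+t≡b+k = subst InBand (sym ∣a-b∣≡t′) (offset-inBand (not β))
    where
      a≡b+t′ : a ≡ b + offset (not β)
      a≡b+t′ = +-cancelʳ-≡ _ _ _ (begin
        a + offset β                      ≡⟨ a+t≡b+k ⟩
        b + k                             ≡⟨ cong (b +_) (offset+offset∘not β) ⟨
        b + (offset β + offset (not β))   ≡⟨ cong (b +_) (+-comm (offset β) _) ⟩
        b + (offset (not β) + offset β)   ≡⟨ +-assoc b _ _ ⟨
        b + offset (not β) + offset β     ∎)
        where open ≡-Reasoning
      ∣a-b∣≡t′ : ∣ a - b ∣ ≡ offset (not β)
      ∣a-b∣≡t′ = trans (∣-∣-comm a b) (trans (cong (∣ b -_∣) a≡b+t′) (∣m-m+n∣≡n b _))

  module ClosedWalk (c : ℕ → ℕ) (step : ∀ i → Σ Bool λ β → c (suc i) ≈ c i + offset β) where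

    β : ℕ → Bool
    β i = proj₁ (step i)

    tally : ∀ n → n * s + trues β n + offset (β n) ≡ suc n * s + trues β (suc n)
    tally n with β n
    ... | false = move-s (n * s) (trues β n) s
      where
        move-s : ∀ a o s → a + o + s ≡ s + a + o
        move-s = solve-∀
    ... | true  = move-suc-s (n * s) (trues β n) s
      where
        move-suc-s : ∀ a o s → a + o + suc s ≡ s + a + suc o
        move-suc-s = solve-∀

    displacement : ∀ n → c n ≈ c 0 + (n * s + trues β n)
    displacement zero    = cong (_% k) (sym (+-identityʳ (c 0)))
    displacement (suc n) = begin
      c (suc n) % k                                        ≡⟨ proj₂ (step n) ⟩
      (c n + offset (β n)) % k                             ≡⟨ +-congʳ-≈ (offset (β n)) (displacement n) ⟩
      (c 0 + (n * s + trues β n) + offset (β n)) % k       ≡⟨ cong (_% k) (+-assoc (c 0) _ _) ⟩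
      (c 0 + (n * s + trues β n + offset (β n))) % k       ≡⟨ cong (λ z → (c 0 + z) % k) (tally n) ⟩
      (c 0 + (suc n * s + trues β (suc n))) % k            ∎
      where open ≡-Reasoning

    trues≈0 : c k ≈ c 0 → trues β k ≈ 0
    trues≈0 closed = begin
      trues β k % k                ≡⟨ [m+kn]%n≡m%n (trues β k) s k ⟨
      (trues β k + s * k) % k      ≡⟨ cong (_% k) (trans (+-comm (trues β k) (s * k)) (cong (_+ trues β k) (*-comm s k))) ⟩
      (k * s + trues β k) % k      ≡⟨ +-cancelˡ-≈ (c 0) (trans (sym (displacement k)) (trans closed (cong (_% k) (sym (+-identityʳ (c 0)))))) ⟩
      0 % k                        ∎
      where open ≡-Reasoning

    uniform-step : c k ≈ c 0 → Σ Bool λ b → ∀ {n} → n ≤ k → c n ≈ c 0 + n * offset b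
    uniform-step closed with ≤∧≈0⇒≡0⊎≡ (trues≤ β k) (trues≈0 closed)
    ... | inj₁ no-trues  = false , λ {n} n≤k →
      trans (displacement n) (cong (λ z → (c 0 + z) % k)
        (trans (cong (n * s +_) (trues≡0-downward β no-trues n≤k)) (+-identityʳ (n * s))))
    ... | inj₂ all-trues = true , λ {n} n≤k →
      trans (displacement n) (cong (λ z → (c 0 + z) % k)
        (trans (cong (n * s +_) (trues≡n-downward β all-trues n≤k)) (trans (+-comm (n * s) n) (sym (*-suc n s)))))

  mod-step⇒close : ∀ {a b} β → b ≈ a + offset β → CkClose (toℕ (a mod k)) (toℕ (b mod k))
  mod-step⇒close {a} {b} β b≈a+t = step⇒close β (toℕ<n _) (toℕ<n _)
    (trans (toℕ-mod-≈ b) (trans b≈a+t (sym (+-congʳ-≈ (offset β) (toℕ-mod-≈ a)))))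

  module _ (G : SimpleGraph) (d : ℕ) where
    open SimpleGraph G

    head tail : Fin m → Fin n
    head e = proj₁ (ends e)
    tail e = proj₂ (ends e)

    replacement-colouring : CkColorable k (Adj G) → CkColorable k (RAdj G d k)
    replacement-colouring (φ , φ-col) = Φ , Φ-col
      where
        colour : Fin n → ℕ
        colour v = toℕ (φ v)

        shift : ∀ e → Σ Bool λ β → colour (tail e) ≈ colour (head e) + offset β
        shift e = close⇒step (φ-col (head e) (tail e) (e , inj₁ refl))

        t : Fin m → ℕ
        t e = offset (proj₁ (shift e))

        label : RVertex G d k → ℕ
        label (inj₁ v)           = d * colour v
        label (inj₂ (e , i , _)) = d * colour (head e) + toℕ i * t e

        label-pos : ∀ e i → label (pos G d k e i) ≈ d * colour (head e) + toℕ i * t e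
        label-pos e i with toℕ i ≟ 0
        ... | yes i≡0 = cong (_% k) (sym (trans (cong (λ z → d * colour (head e) + z * t e) i≡0) (+-identityʳ _)))
        ... | no _ with toℕ i ≟ d
        ...   | yes i≡d = begin
          d * colour (tail e) % k                    ≡⟨ *-congˡ-≈ d (proj₂ (shift e)) ⟩
          d * (colour (head e) + t e) % k            ≡⟨ cong (_% k) (*-distribˡ-+ d _ _) ⟩
          (d * colour (head e) + d * t e) % k        ≡⟨ cong (λ z → (d * colour (head e) + z * t e) % k) i≡d ⟨
          (d * colour (head e) + toℕ i * t e) % k    ∎
          where open ≡-Reasoning
        ...   | no _ = refl

        label-step : ∀ e {i j} → CycAdj k i j → label (pos G d k e j) ≈ label (pos G d k e i) + t e
        label-step e {i} {j} adj = begin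
          label (pos G d k e j) % k                  ≡⟨ label-pos e j ⟩
          (dx + toℕ j * t e) % k                     ≡⟨ +-congˡ-≈ dx (*-congʳ-≈ (t e) (cycAdj⇒≈suc adj)) ⟩
          (dx + (t e + toℕ i * t e)) % k             ≡⟨ cong (λ z → (dx + z) % k) (+-comm (t e) _) ⟩
          (dx + (toℕ i * t e + t e)) % k             ≡⟨ cong (_% k) (+-assoc dx _ _) ⟨
          (dx + toℕ i * t e + t e) % k               ≡⟨ +-congʳ-≈ (t e) (label-pos e i) ⟨
          (label (pos G d k e i) + t e) % k          ∎
          where
            open ≡-Reasoning
            dx : ℕ
            dx = d * colour (head e)

        Φ : RVertex G d k → Fin k
        Φ v = label v mod k

        colour-step : ∀ e {i j} → CycAdj k i j → CkClose (toℕ (Φ (pos G d k e i))) (toℕ (Φ (pos G d k e j)))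
        colour-step e adj = mod-step⇒close (proj₁ (shift e)) (label-step e adj)

        Φ-col : IsCkColoring k (RAdj G d k) Φ
        Φ-col _ _ (e , i , j , adj , inj₁ (refl , refl)) = colour-step e adj
        Φ-col _ _ (e , i , j , adj , inj₂ (refl , refl)) =
          CkClose-sym (toℕ (Φ (pos G d k e i))) (toℕ (Φ (pos G d k e j))) (colour-step e adj)

    replacement-colouring⁻¹ : ∀ d⁻¹ → 0 < d → d < k → d⁻¹ * d ≈ 1 → CkColorable k (RAdj G d k) → CkColorable k (Adj G)
    replacement-colouring⁻¹ d⁻¹ 0<d d<k d⁻¹*d≈1 (Φ , Φ-col) = φ , φ-col
      where
        colour : RVertex G d k → ℕ
        colour v = toℕ (Φ v)

        φ : Fin n → Fin k
        φ v = d⁻¹ * colour (inj₁ v) mod k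

        walk : Fin m → ℕ → ℕ
        walk e i = colour (pos G d k e (i mod k))

        shift : ∀ e i → Σ Bool λ β → walk e (suc i) ≈ walk e i + offset β
        shift e i = close⇒step (Φ-col _ _ (e , i mod k , suc i mod k , cycAdj-mod i , inj₁ (refl , refl)))

        toℕ[0-mod-k]≡0 : toℕ (0 mod k) ≡ 0
        toℕ[0-mod-k]≡0 = trans (toℕ-fromℕ< _) (m*n%n≡0 0 k)

        walk-closed : ∀ e → walk e k ≡ walk e 0
        walk-closed e = cong (colour ∘ pos G d k e)
          (toℕ-injective (trans (trans (toℕ-fromℕ< _) (n%n≡0 k)) (sym toℕ[0-mod-k]≡0)))

        walk-head : ∀ e → walk e 0 ≡ colour (inj₁ (head e))
        walk-head e = cong colour (pos-head G d k e (0 mod k) toℕ[0-mod-k]≡0)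

        walk-tail : ∀ e → walk e d ≡ colour (inj₁ (tail e))
        walk-tail e = cong colour (pos-tail G d k (n>0⇒n≢0 0<d) e (d mod k) (trans (toℕ-fromℕ< _) (m<n⇒m%n≡m d<k)))

        edge-step : ∀ e → Σ Bool λ β → colour (inj₁ (tail e)) ≈ colour (inj₁ (head e)) + d * offset β
        edge-step e = map₂ (λ {β} uniform → subst₂ (λ y x → y ≈ x + d * offset β) (walk-tail e) (walk-head e) (uniform (<⇒≤ d<k)))
          (ClosedWalk.uniform-step (walk e) (shift e) (cong (_% k) (walk-closed e)))

        edge-close : ∀ e → CkClose (toℕ (φ (head e))) (toℕ (φ (tail e)))
        edge-close e = mod-step⇒close (proj₁ (edge-step e)) (y≈x+dt⇒d⁻¹y≈d⁻¹x+t d d⁻¹ d⁻¹*d≈1 (proj₂ (edge-step e)))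

        φ-col : IsCkColoring k (Adj G) φ
        φ-col u v (e , inj₁ e≡uv) =
          subst₂ (λ u v → CkClose (toℕ (φ u)) (toℕ (φ v))) (cong proj₁ e≡uv) (cong proj₂ e≡uv) (edge-close e)
        φ-col u v (e , inj₂ e≡vu) = CkClose-sym (toℕ (φ v)) (toℕ (φ u))
          (subst₂ (λ v u → CkClose (toℕ (φ v)) (toℕ (φ u))) (cong proj₁ e≡vu) (cong proj₂ e≡vu) (edge-close e))

k≡1+2[k/2] : ∀ k → k % 2 ≡ 1 → k ≡ suc (k / 2 + k / 2)
k≡1+2[k/2] k k-odd = trans (m≡m%n+[m/n]*n k 2)
  (cong₂ _+_ k-odd (trans (*-comm (k / 2) 2) (cong (k / 2 +_) (+-identityʳ (k / 2)))))

proposition2p2 : (k d : ℕ) → 3 ≤ k → k % 2 ≡ 1 → 1 ≤ d → d ≤ k ∸ 1 → gcd d k ≡ 1 →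
    (G : SimpleGraph) →
    CkColorable k (Adj G) ⇔ CkColorable k (RAdj G d k)
proposition2p2 k d _ k-odd 0<d d≤k∸1 gcd≡1 G =
  mk⇔ (replacement-colouring G d) (replacement-colouring⁻¹ G d d⁻¹ 0<d d<k d⁻¹*d≈1)
  where
    k≡1+2s : k ≡ suc (k / 2 + k / 2)
    k≡1+2s = k≡1+2[k/2] k k-odd
    open OddCycle {s = k / 2} k≡1+2s
    open Modular k
    d⁻¹ : ℕ
    d⁻¹ = proj₁ (gcd≡1⇒invertible {d} gcd≡1)
    d⁻¹*d≈1 : d⁻¹ * d ≈ 1
    d⁻¹*d≈1 = proj₂ (gcd≡1⇒invertible {d} gcd≡1)
    d<k : d < k
    d<k = subst (d <_) (sym k≡1+2s) (s≤s (subst (λ k → d ≤ k ∸ 1) k≡1+2s d≤k∸1))
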